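{- Let $G$ and $H$ be connected graphs, each with at least two vertices. Let $u,x\in V(G)$ and $v,y\in V(H)$. Then $(u,v)$ and $(x,y)$ are mutually maximally distant vertices in the strong product $G\boxtimes H$ if and only if at least one of the following conditions holds: (i) $u,x$ are mutually maximally distant in $G$ and $v,y$ are mutually maximally distant in $H$; (ii) $u,x$ are mutually maximally distant in $G$ and $v=y$; (iii) $v,y$ are mutually maximally distant in $H$ and $u=x$; (iv) $u,x$ are mutually maximally distant in $G$ and $d_G(u,x)>d_H(v,y)$; (v) $v,y$ are mutually maximally distant in $H$ and $d_G(u,x)<d_H(v,y)$.
   Context: All graphs are finite and simple; $d_G$ denotes the shortest-path distance in $G$ and $N_G(u)$ the set of neighbours of $u$. A vertex $u$ is maximally distant from a vertex $v$ in $G$ if $d_G(v,w)\le d_G(u,v)$ for every $w\in N_G(u)$; $u$ and $v$ are mutually maximally distant if $u$ is maximally distant from $v$ and $v$ is maximally distant from $u$. The strong product $G\boxtimes H$ has vertex set $V(G)\times V(H)$, with $(a,b)$ and $(c,d)$ adjacent iff either ($a=c$ and $bd\in E(H)$), or ($ac\in E(G)$ and $b=d$), or ($ac\in E(G)$ and $bd\in E(H)$). -}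

module Defs where

open import Data.Nat using (ℕ; zero; suc; _*_; _≤_; _<_)
open import Data.Fin using (Fin)
open import Data.Fin.Properties using (*↔×)
open import Data.Product using (Σ; ∃; _×_; _,_; proj₁; proj₂)
open import Data.Product.Properties using (≡-dec)
open import Data.Product.Function.NonDependent.Propositional using (_×-↔_)
open import Data.Sum using (_⊎_; inj₁; inj₂)
open import Relation.Nullary using (¬_; Dec; yes; no)
open import Relation.Nullary.Decidable using (_×-dec_; _⊎-dec_)
open import Relation.Binary.Definitions using (DecidableEquality)
open import Relation.Binary.PropositionalEquality using (_≡_; refl; sym)
open import Function.Bundles using (_↔_)
open import Function.Properties.Inverse using (↔-trans)

record Graph : Set₁ where
  field
    V      : Set
    order  : ℕ
    enum   : Fin order ↔ V
    _≟_    : DecidableEquality V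
    Adj    : V → V → Set
    adj?   : (u v : V) → Dec (Adj u v)
    adj-sym   : ∀ {u v} → Adj u v → Adj v u
    adj-irrefl : ∀ {u} → ¬ Adj u u

open Graph public

data Walk (G : Graph) : V G → V G → ℕ → Set where
  [] : ∀ {u} → Walk G u u zero
  _∷_ : ∀ {u w v k} → Adj G u w → Walk G w v k → Walk G u v (suc k)

Dist : (G : Graph) → V G → V G → ℕ → Set
Dist G u v k = Walk G u v k × (∀ m → Walk G u v m → k ≤ m)

Connected : Graph → Set
Connected G = ∀ (u v : V G) → ∃ λ k → Walk G u v k

MaxDistFrom : (G : Graph) → V G → V G → Set
MaxDistFrom G u v = ∀ w → Adj G u w → ∀ a b → Dist G v w a → Dist G u v b → a ≤ b

MutuallyMaxDist : (G : Graph) → V G → V G → Set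
MutuallyMaxDist G u v = MaxDistFrom G u v × MaxDistFrom G v u

StrongAdj : (G H : Graph) → V G × V H → V G × V H → Set
StrongAdj G H (a , b) (c , d) =
  (a ≡ c × Adj H b d) ⊎ ((Adj G a c × b ≡ d) ⊎ (Adj G a c × Adj H b d))

_⊠_ : Graph → Graph → Graph
G ⊠ H = record
  { V = V G × V H
  ; order = order G * order H
  ; enum = ↔-trans *↔× (enum G ×-↔ enum H)
  ; _≟_ = ≡-dec (_≟_ G) (_≟_ H)
  ; Adj = StrongAdj G H
  ; adj? = λ { (a , b) (c , d) →
      ((_≟_ G a c) ×-dec (adj? H b d)) ⊎-dec
      (((adj? G a c) ×-dec (_≟_ H b d)) ⊎-dec ((adj? G a c) ×-dec (adj? H b d))) }
  ; adj-sym = λ { (inj₁ (p , q)) → inj₁ (sym p , adj-sym H q)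
                ; (inj₂ (inj₁ (p , q))) → inj₂ (inj₁ (adj-sym G p , sym q))
                ; (inj₂ (inj₂ (p , q))) → inj₂ (inj₂ (adj-sym G p , adj-sym H q)) }
  ; adj-irrefl = λ { (inj₁ (_ , q)) → adj-irrefl H q
                   ; (inj₂ (inj₁ (p , _))) → adj-irrefl G p
                   ; (inj₂ (inj₂ (p , _))) → adj-irrefl G p }
  }

-- In the strong product a step may move in either factor, in both, and the distance is the maximum
-- d((u,v),(x,y)) = d_G(u,x) ⊔ d_H(v,y). Hence (u,v) is maximally distant from (x,y) iff every closed
-- neighbour of u is within d_G(u,x) ⊔ d_H(v,y) of x in G, and likewise in H. When d_G(u,x) > d_H(v,y)
-- the H-condition holds for free (a neighbour of v is within d_H(v,y) + 1 of y) and the G-condition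
-- says exactly that u is maximally distant from x; the other cases are symmetric, and v = y is the
-- instance d_H(v,y) = 0 < d_G(u,x), the latter positive because a maximally distant vertex has a
-- neighbour, which cannot be closer.
module Submission where

open import Defs
open import Data.Nat using (ℕ; zero; suc; _≤_; _<_; _⊔_; z≤n; s≤s)
open import Data.Nat.Properties
  using (≤-refl; ≤-reflexive; ≤-trans; ≤-antisym; <-cmp; ≮⇒≥; m≤n⇒m≤1+n; n≤1+n; <⇒≤; anyUpTo?;
         ⊔-lub; m≤m⊔n; m≤n⊔m)
open import Data.Nat.Induction using (<-wellFounded)
open import Induction.WellFounded using (Acc; acc)
open import Data.Fin using () renaming (zero to fzero; suc to fsuc)
open import Data.Fin.Properties using (any?; 0≢1+n)
open import Data.Product using (∃; _×_; _,_; proj₁; proj₂)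
open import Data.Product.Function.NonDependent.Propositional using (_×-⇔_)
open import Data.Sum using (_⊎_; inj₁; inj₂)
open import Data.Empty using (⊥-elim)
open import Relation.Nullary using (¬_; Dec; yes; no)
open import Relation.Nullary.Decidable using (_×-dec_)
open import Relation.Unary using (Decidable)
open import Relation.Binary using (tri<; tri≈; tri>)
open import Relation.Binary.PropositionalEquality using (_≡_; refl; sym; trans; subst)
open import Function using (_∘_)
open import Function.Bundles using (_⇔_; mk⇔; Equivalence; Inverse; Injection)
open import Function.Properties.Inverse using (↔⇒↣)

module _ {p} {P : ℕ → Set p} (P? : Decidable P) where

  least-witness : ∀ {n} → P n → ∃ λ k → P k × (∀ m → P m → k ≤ m)
  least-witness {n} = go n (<-wellFounded n)
    where
    go : ∀ n → Acc _<_ n → P n → ∃ λ k → P k × (∀ m → P m → k ≤ m)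
    go n (acc rs) Pn with anyUpTo? P? n
    ... | yes (m , m<n , Pm) = go m (rs m<n) Pm
    ... | no none = n , Pn , λ m Pm → ≮⇒≥ (λ m<n → none (m , m<n , Pm))

AdjOrEq : (G : Graph) → V G → V G → Set
AdjOrEq G u w = u ≡ w ⊎ Adj G u w

module _ {G H : Graph} (f : V G → V H) (f-adj : ∀ {a c} → Adj G a c → AdjOrEq H (f a) (f c)) where

  walk-shadow : ∀ {u v k} → Walk G u v k → ∃ λ j → j ≤ k × Walk H (f u) (f v) j
  walk-shadow [] = 0 , z≤n , []
  walk-shadow (e ∷ p) with f-adj e | walk-shadow p
  ... | inj₁ eq | j , j≤k , q = j , m≤n⇒m≤1+n j≤k , subst (λ z → Walk H z (f _) j) (sym eq) q
  ... | inj₂ e′ | j , j≤k , q = suc j , s≤s j≤k , e′ ∷ q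

module _ {G H : Graph} (f : V G → V H) (f-adj : ∀ {a c} → Adj G a c → Adj H (f a) (f c)) where

  walk-map : ∀ {u v k} → Walk G u v k → Walk H (f u) (f v) k
  walk-map [] = []
  walk-map (e ∷ p) = f-adj e ∷ walk-map p

module _ (G : Graph) where

  _∷ʳ_ : ∀ {u v w k} → Walk G u v k → Adj G v w → Walk G u w (suc k)
  [] ∷ʳ e = e ∷ []
  (e′ ∷ p) ∷ʳ e = e′ ∷ (p ∷ʳ e)

  reverse : ∀ {u v k} → Walk G u v k → Walk G v u k
  reverse [] = []
  reverse (e ∷ p) = reverse p ∷ʳ adj-sym G e

  dist-sym : ∀ {u v k} → Dist G u v k → Dist G v u k
  dist-sym (p , min) = reverse p , λ m q → min m (reverse q)

  dist-unique : ∀ {u v a b} → Dist G u v a → Dist G u v b → a ≡ b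
  dist-unique (p , minp) (q , minq) = ≤-antisym (minp _ q) (minq _ p)

  dist-refl : ∀ {u} → Dist G u u 0
  dist-refl = [] , λ _ _ → z≤n

  dist-zero⇒≡ : ∀ {u v} → Dist G u v 0 → u ≡ v
  dist-zero⇒≡ ([] , _) = refl

  open Inverse (enum G) using (to; from; strictlyInverseˡ)

  walk? : ∀ k u v → Dec (Walk G u v k)
  walk? zero u v with _≟_ G u v
  ... | yes refl = yes []
  ... | no u≢v = no λ { [] → u≢v refl }
  walk? (suc k) u v
    with any? {P = λ i → Adj G u (to i) × Walk G (to i) v k} (λ i → adj? G u (to i) ×-dec walk? k (to i) v)
  ... | yes (_ , e , p) = yes (e ∷ p)
  ... | no none = no λ { (_∷_ {w = w} e p) →
          none (from w , subst (λ z → Adj G u z × Walk G z v k) (sym (strictlyInverseˡ w)) (e , p)) }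

  dist-exists : Connected G → ∀ u v → ∃ (Dist G u v)
  dist-exists conn u v = least-witness (λ k → walk? k u v) (proj₂ (conn u v))

  other-vertex : 2 ≤ order G → (u : V G) → ∃ λ w → ¬ u ≡ w
  other-vertex (s≤s (s≤s _)) u with _≟_ G u (to fzero)
  ... | no u≢v₀ = to fzero , u≢v₀
  ... | yes u≡v₀ = to (fsuc fzero) , λ u≡v₁ → v₀≢v₁ (trans (sym u≡v₀) u≡v₁)
    where
    v₀≢v₁ : ¬ to fzero ≡ to (fsuc fzero)
    v₀≢v₁ = 0≢1+n ∘ Injection.injective (↔⇒↣ (enum G))

  walk-first-step : ∀ {u w k} → ¬ u ≡ w → Walk G u w k → ∃ (Adj G u)
  walk-first-step u≢w [] = ⊥-elim (u≢w refl)
  walk-first-step _ (e ∷ _) = _ , e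

  neighbour-exists : Connected G → 2 ≤ order G → ∀ u → ∃ (Adj G u)
  neighbour-exists conn two u with other-vertex two u
  ... | w , u≢w = walk-first-step u≢w (proj₂ (conn u w))

  maxDistFrom-dist-pos : Connected G → 2 ≤ order G → ∀ {u x a} → MaxDistFrom G u x → Dist G u x a → 0 < a
  maxDistFrom-dist-pos _ _ {a = suc _} _ _ = s≤s z≤n
  maxDistFrom-dist-pos conn two {u} {a = zero} md d with dist-zero⇒≡ d
  ... | refl with neighbour-exists conn two u
  ... | w , e with dist-exists conn u w
  ... | a , dw with md w e a 0 dw dist-refl
  ... | z≤n = ⊥-elim (adj-irrefl G (subst (Adj G u) (sym (dist-zero⇒≡ dw)) e))

  NbhdWithin : V G → V G → ℕ → Set
  NbhdWithin u x n = ∀ {w a} → AdjOrEq G u w → Dist G x w a → a ≤ n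

  nbhdWithin-mono : ∀ {u x n m} → n ≤ m → NbhdWithin u x n → NbhdWithin u x m
  nbhdWithin-mono n≤m within uw dw = ≤-trans (within uw dw) n≤m

  nbhdWithin-suc : ∀ {u x a} → Dist G u x a → NbhdWithin u x (suc a)
  nbhdWithin-suc d (inj₁ refl) dw = ≤-trans (≤-reflexive (dist-unique dw (dist-sym d))) (n≤1+n _)
  nbhdWithin-suc d (inj₂ e) (_ , min) = min _ (reverse (proj₁ d) ∷ʳ e)

  maxDistFrom⇔nbhdWithin : ∀ {u x a} → Dist G u x a → MaxDistFrom G u x ⇔ NbhdWithin u x a
  maxDistFrom⇔nbhdWithin d = mk⇔
    (λ { md (inj₁ refl) dw → ≤-reflexive (dist-unique dw (dist-sym d))
       ; md (inj₂ e) dw → md _ e _ _ dw d })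
    (λ within w e a b dw d′ → subst (a ≤_) (dist-unique d d′) (within (inj₂ e) dw))

  MutuallyWithin : V G → V G → ℕ → Set
  MutuallyWithin u x n = NbhdWithin u x n × NbhdWithin x u n

  mutuallyWithin-mono : ∀ {u x n m} → n ≤ m → MutuallyWithin u x n → MutuallyWithin u x m
  mutuallyWithin-mono n≤m (ux , xu) = nbhdWithin-mono n≤m ux , nbhdWithin-mono n≤m xu

  mutuallyWithin-suc : ∀ {u x a} → Dist G u x a → MutuallyWithin u x (suc a)
  mutuallyWithin-suc d = nbhdWithin-suc d , nbhdWithin-suc (dist-sym d)

  mutuallyMaxDist⇔mutuallyWithin : ∀ {u x a} → Dist G u x a →
    MutuallyMaxDist G u x ⇔ MutuallyWithin u x a
  mutuallyMaxDist⇔mutuallyWithin d = maxDistFrom⇔nbhdWithin d ×-⇔ maxDistFrom⇔nbhdWithin (dist-sym d)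

  mutuallyWithin⇒mutuallyMaxDist : ∀ {u x a n} → Dist G u x a → n ≤ a →
    MutuallyWithin u x n → MutuallyMaxDist G u x
  mutuallyWithin⇒mutuallyMaxDist d n≤a =
    Equivalence.from (mutuallyMaxDist⇔mutuallyWithin d) ∘ mutuallyWithin-mono n≤a

module _ (G H : Graph) where

  private
    P = G ⊠ H

  adjOrEq-⊠ : ∀ {p q} → AdjOrEq P p q → AdjOrEq G (proj₁ p) (proj₁ q) × AdjOrEq H (proj₂ p) (proj₂ q)
  adjOrEq-⊠ (inj₁ refl) = inj₁ refl , inj₁ refl
  adjOrEq-⊠ (inj₂ (inj₁ (refl , e))) = inj₁ refl , inj₂ e
  adjOrEq-⊠ (inj₂ (inj₂ (inj₁ (e , refl)))) = inj₂ e , inj₁ refl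
  adjOrEq-⊠ (inj₂ (inj₂ (inj₂ (e , f)))) = inj₂ e , inj₂ f

  adjOrEq-⊠ˡ : ∀ {u w v} → AdjOrEq G u w → AdjOrEq P (u , v) (w , v)
  adjOrEq-⊠ˡ (inj₁ refl) = inj₁ refl
  adjOrEq-⊠ˡ (inj₂ e) = inj₂ (inj₂ (inj₁ (e , refl)))

  adjOrEq-⊠ʳ : ∀ {u v w} → AdjOrEq H v w → AdjOrEq P (u , v) (u , w)
  adjOrEq-⊠ʳ (inj₁ refl) = inj₁ refl
  adjOrEq-⊠ʳ (inj₂ f) = inj₂ (inj₁ (refl , f))

  walk-⊠ : ∀ {u x v y a b} → Walk G u x a → Walk H v y b → Walk P (u , v) (x , y) (a ⊔ b)
  walk-⊠ {u} [] q = walk-map (u ,_) (λ f → inj₁ (refl , f)) q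
  walk-⊠ {v = v} (e ∷ p) [] = walk-map (_, v) (λ e → inj₂ (inj₁ (e , refl))) (e ∷ p)
  walk-⊠ (e ∷ p) (f ∷ q) = inj₂ (inj₂ (e , f)) ∷ walk-⊠ p q

  dist-⊠ : ∀ {u x v y a b} → Dist G u x a → Dist H v y b → Dist P (u , v) (x , y) (a ⊔ b)
  dist-⊠ (p , minp) (q , minq) = walk-⊠ p q , λ k r →
    ⊔-lub (bound minp (walk-shadow proj₁ (λ e → proj₁ (adjOrEq-⊠ (inj₂ e))) r))
          (bound minq (walk-shadow proj₂ (λ e → proj₂ (adjOrEq-⊠ (inj₂ e))) r))
    where
    bound : ∀ {K : Graph} {s t n k} → (∀ m → Walk K s t m → n ≤ m) →
            ∃ (λ j → j ≤ k × Walk K s t j) → n ≤ k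
    bound min (j , j≤k , r) = ≤-trans (min j r) j≤k

  module ConnectedFactors (connG : Connected G) (connH : Connected H) where

    open Equivalence

    nbhdWithin-⊠⇔ : ∀ {u x v y n} →
      NbhdWithin P (u , v) (x , y) n ⇔ (NbhdWithin G u x n × NbhdWithin H v y n)
    nbhdWithin-⊠⇔ {u} {x} {v} {y} {n} = mk⇔ split join
      where
      split : NbhdWithin P (u , v) (x , y) n → NbhdWithin G u x n × NbhdWithin H v y n
      split within =
        (λ uw dw → ≤-trans (m≤m⊔n _ _) (within (adjOrEq-⊠ˡ uw) (dist-⊠ dw (proj₂ (dist-exists H connH y v))))) ,
        (λ vw dw → ≤-trans (m≤n⊔m _ _) (within (adjOrEq-⊠ʳ vw) (dist-⊠ (proj₂ (dist-exists G connG x u)) dw)))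
      join : NbhdWithin G u x n × NbhdWithin H v y n → NbhdWithin P (u , v) (x , y) n
      join (withinG , withinH) {w , w′} uvw dw
        with dist-exists G connG x w | dist-exists H connH y w′ | adjOrEq-⊠ uvw
      ... | a , da | b , db | uw , vw =
        subst (_≤ n) (dist-unique P (dist-⊠ da db) dw) (⊔-lub (withinG uw da) (withinH vw db))

    mutuallyMaxDist-⊠⇔ : ∀ {u x v y a b} → Dist G u x a → Dist H v y b →
      MutuallyMaxDist P (u , v) (x , y) ⇔ (MutuallyWithin G u x (a ⊔ b) × MutuallyWithin H v y (a ⊔ b))
    mutuallyMaxDist-⊠⇔ {u} {x} {v} {y} {a} {b} dG dH = mk⇔ split join
      where
      within : MutuallyMaxDist P (u , v) (x , y) ⇔ MutuallyWithin P (u , v) (x , y) (a ⊔ b)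
      within = mutuallyMaxDist⇔mutuallyWithin P (dist-⊠ dG dH)
      split : MutuallyMaxDist P (u , v) (x , y) → MutuallyWithin G u x (a ⊔ b) × MutuallyWithin H v y (a ⊔ b)
      split mmd with to within mmd
      ... | uv , xy with to nbhdWithin-⊠⇔ uv | to nbhdWithin-⊠⇔ xy
      ... | uxG , vyH | xuG , yvH = (uxG , xuG) , (vyH , yvH)
      join : MutuallyWithin G u x (a ⊔ b) × MutuallyWithin H v y (a ⊔ b) → MutuallyMaxDist P (u , v) (x , y)
      join ((uxG , xuG) , (vyH , yvH)) =
        from within (from nbhdWithin-⊠⇔ (uxG , vyH) , from nbhdWithin-⊠⇔ (xuG , yvH))

    mutuallyMaxDist-⊠-both : ∀ {u x v y} → MutuallyMaxDist G u x → MutuallyMaxDist H v y →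
      MutuallyMaxDist P (u , v) (x , y)
    mutuallyMaxDist-⊠-both {u} {x} {v} {y} mG mH
      with dist-exists G connG u x | dist-exists H connH v y
    ... | a , dG | b , dH = from (mutuallyMaxDist-⊠⇔ dG dH)
      ( mutuallyWithin-mono G (m≤m⊔n a b) (to (mutuallyMaxDist⇔mutuallyWithin G dG) mG)
      , mutuallyWithin-mono H (m≤n⊔m a b) (to (mutuallyMaxDist⇔mutuallyWithin H dH) mH))

    mutuallyMaxDist-⊠-dominantˡ : ∀ {u x v y a b} → MutuallyMaxDist G u x →
      Dist G u x a → Dist H v y b → b < a → MutuallyMaxDist P (u , v) (x , y)
    mutuallyMaxDist-⊠-dominantˡ {a = a} {b} mG dG dH b<a = from (mutuallyMaxDist-⊠⇔ dG dH)
      ( mutuallyWithin-mono G (m≤m⊔n a b) (to (mutuallyMaxDist⇔mutuallyWithin G dG) mG)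
      , mutuallyWithin-mono H (≤-trans b<a (m≤m⊔n a b)) (mutuallyWithin-suc H dH))

    mutuallyMaxDist-⊠-dominantʳ : ∀ {u x v y a b} → MutuallyMaxDist H v y →
      Dist G u x a → Dist H v y b → a < b → MutuallyMaxDist P (u , v) (x , y)
    mutuallyMaxDist-⊠-dominantʳ {a = a} {b} mH dG dH a<b = from (mutuallyMaxDist-⊠⇔ dG dH)
      ( mutuallyWithin-mono G (≤-trans a<b (m≤n⊔m a b)) (mutuallyWithin-suc G dG)
      , mutuallyWithin-mono H (m≤n⊔m a b) (to (mutuallyMaxDist⇔mutuallyWithin H dH) mH))

lemma6 : (G H : Graph) → Connected G → Connected H → 2 ≤ order G → 2 ≤ order H →
    (u x : V G) (v y : V H) →
    MutuallyMaxDist (G ⊠ H) (u , v) (x , y) ⇔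
      ((MutuallyMaxDist G u x × MutuallyMaxDist H v y)
      ⊎ ((MutuallyMaxDist G u x × v ≡ y)
      ⊎ ((MutuallyMaxDist H v y × u ≡ x)
      ⊎ ((MutuallyMaxDist G u x × (∃ λ a → ∃ λ b → Dist G u x a × Dist H v y b × b < a))
      ⊎ (MutuallyMaxDist H v y × (∃ λ a → ∃ λ b → Dist G u x a × Dist H v y b × a < b))))))
lemma6 G H connG connH twoG twoH u x v y
  with dist-exists G connG u x | dist-exists H connH v y
... | a , dG | b , dH = mk⇔ forward backward
  where
  open Equivalence using (to)
  open ConnectedFactors G H connG connH

  Conditions : Set
  Conditions =
    (MutuallyMaxDist G u x × MutuallyMaxDist H v y)
    ⊎ ((MutuallyMaxDist G u x × v ≡ y)
    ⊎ ((MutuallyMaxDist H v y × u ≡ x)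
    ⊎ ((MutuallyMaxDist G u x × (∃ λ a → ∃ λ b → Dist G u x a × Dist H v y b × b < a))
    ⊎ (MutuallyMaxDist H v y × (∃ λ a → ∃ λ b → Dist G u x a × Dist H v y b × a < b)))))

  forward : MutuallyMaxDist (G ⊠ H) (u , v) (x , y) → Conditions
  forward mmd with to (mutuallyMaxDist-⊠⇔ dG dH) mmd | <-cmp a b
  ... | _ , wH | tri< a<b _ _ =
    inj₂ (inj₂ (inj₂ (inj₂ (mutuallyWithin⇒mutuallyMaxDist H dH (⊔-lub (<⇒≤ a<b) ≤-refl) wH ,
                            a , b , dG , dH , a<b))))
  ... | wG , wH | tri≈ _ refl _ =
    inj₁ ( mutuallyWithin⇒mutuallyMaxDist G dG (⊔-lub ≤-refl ≤-refl) wG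
         , mutuallyWithin⇒mutuallyMaxDist H dH (⊔-lub ≤-refl ≤-refl) wH)
  ... | wG , _ | tri> _ _ b<a =
    inj₂ (inj₂ (inj₂ (inj₁ (mutuallyWithin⇒mutuallyMaxDist G dG (⊔-lub ≤-refl (<⇒≤ b<a)) wG ,
                            a , b , dG , dH , b<a))))

  backward : Conditions → MutuallyMaxDist (G ⊠ H) (u , v) (x , y)
  backward (inj₁ (mG , mH)) = mutuallyMaxDist-⊠-both mG mH
  backward (inj₂ (inj₁ (mG , refl))) = mutuallyMaxDist-⊠-dominantˡ mG dG (dist-refl H)
    (maxDistFrom-dist-pos G connG twoG (proj₁ mG) dG)
  backward (inj₂ (inj₂ (inj₁ (mH , refl)))) = mutuallyMaxDist-⊠-dominantʳ mH (dist-refl G) dH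
    (maxDistFrom-dist-pos H connH twoH (proj₁ mH) dH)
  backward (inj₂ (inj₂ (inj₂ (inj₁ (mG , _ , _ , dG′ , dH′ , b<a))))) =
    mutuallyMaxDist-⊠-dominantˡ mG dG′ dH′ b<a
  backward (inj₂ (inj₂ (inj₂ (inj₂ (mH , _ , _ , dG′ , dH′ , a<b))))) =
    mutuallyMaxDist-⊠-dominantʳ mH dG′ dH′ a<b
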